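{- Let $M$ be a weakly round matroid and let $X,Y \subseteq E(M)$ with $r_M(X) < r_M(Y)$. Then there is a minor $N$ of $M$ such that $N|X = M|X$, $N|Y = M|Y$, and $Y$ is spanning in $N$.
   Context: All matroids are finite. A matroid $M$ is weakly round if there do not exist sets $A,B$ with $A \cup B = E(M)$, $r_M(A) \le r(M)-2$ and $r_M(B) \le r(M)-1$. -}

module Defs where

open import Data.Nat using (ℕ; _+_; _≤_; _∸_)
open import Data.Fin.Subset using (Subset; _⊆_; _∪_; _∩_; ∁; ⊤; ⊥; ∣_∣)
open import Data.Product using (Σ; ∃; _×_)
open import Relation.Binary.PropositionalEquality using (_≡_)
open import Relation.Nullary using (¬_)

record Matroid (n : ℕ) : Set where
  field
    r        : Subset n → ℕ
    r-card   : ∀ X → r X ≤ ∣ X ∣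
    r-mono   : ∀ {X Y} → X ⊆ Y → r X ≤ r Y
    r-submod : ∀ X Y → r (X ∪ Y) + r (X ∩ Y) ≤ r X + r Y

open Matroid public

rankM : ∀ {n} → Matroid n → ℕ
rankM M = r M ⊤

-- Weakly round: no A, B with A ∪ B = E(M), r(A) ≤ r(M) - 2, r(B) ≤ r(M) - 1
-- (integer inequalities, written additively to avoid truncated subtraction).
WeaklyRound : ∀ {n} → Matroid n → Set
WeaklyRound {n} M =
  ¬ (Σ (Subset n) λ A → Σ (Subset n) λ B →
       (A ∪ B ≡ ⊤) × (r M A + 2 ≤ rankM M) × (r M B + 1 ≤ rankM M))

-- The minor N = M / C \ D (C, D disjoint) has ground set E(N) = E - (C ∪ D)
-- and rank function r_N(Z) = r_M(Z ∪ C) - r_M(C) for Z ⊆ E(N).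
-- Every minor of M has this form.
groundMinor : ∀ {n} → Subset n → Subset n → Subset n
groundMinor C D = ∁ (C ∪ D)

rankMinor : ∀ {n} → Matroid n → Subset n → Subset n → ℕ
rankMinor M C Z = r M (Z ∪ C) ∸ r M C

GoodMinor : ∀ {n} → Matroid n → Subset n → Subset n → Subset n → Subset n → Set
GoodMinor M X Y C D =
  (C ∩ D ≡ ⊥) ×
  (X ⊆ groundMinor C D) × (∀ Z → Z ⊆ X → rankMinor M C Z ≡ r M Z) ×
  (Y ⊆ groundMinor C D) × (∀ Z → Z ⊆ Y → rankMinor M C Z ≡ r M Z) ×
  (rankMinor M C Y ≡ rankMinor M C (groundMinor C D))

-- Contract, one at a time, elements lying outside both cl(X ∪ C) and cl(Y ∪ C),
-- where C is the set contracted so far. Each contraction keeps X and Y skew to the contracted set C, so M / C agrees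
-- with M on X and on Y, and it raises r(Y ∪ C); once Y ∪ C spans X ∪ Y ∪ C,
-- deleting everything else makes Y spanning. Such an element exists as long as
-- Y ∪ C is not spanning: otherwise cl(X ∪ C) ∪ cl(Y ∪ C) = E with
-- r(cl(X ∪ C)) ≤ r(X) + r(C) < r(Y ∪ C) < r(M), against weak roundness.
module Submission where

open import Defs
open import Data.Nat using (ℕ; zero; suc; _<_; _≤_; _+_; _∸_; _≤?_; _≤ᵇ_; s≤s)
open import Data.Nat.Properties
open import Data.Bool.Properties using (T-≡)
open import Data.Fin using (Fin)
open import Data.Fin.Subset
open import Data.Fin.Subset.Properties
open import Data.Fin.Properties using (any?)
open import Data.Product using (Σ; ∃; _×_; _,_)
open import Data.Sum using (inj₁; inj₂; [_,_]′)
open import Data.Vec using (tabulate)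
open import Data.Vec.Properties using (lookup∘tabulate; []=⇒lookup; lookup⇒[]=)
open import Data.List using (List; []; _∷_; map; filter; allFin)
open import Data.List.Relation.Unary.All using (All; []; _∷_)
open import Data.List.Relation.Unary.All.Properties using (all-filter)
open import Data.List.Relation.Unary.Any using (here; there)
open import Data.List.Membership.Propositional using () renaming (_∈_ to _∈ₗ_)
open import Data.List.Membership.Propositional.Properties using (∈-filter⁺; ∈-allFin)
open import Function using (_∘_)
open import Function.Bundles using (Equivalence)
open import Relation.Binary.PropositionalEquality using (_≡_; refl; sym; trans; cong; subst; module ≡-Reasoning)
open import Relation.Nullary using (yes; no; ¬?; contradiction)
open import Relation.Nullary.Decidable using (_×-dec_)

∪-⊆ : ∀ {n} {A B C : Subset n} → A ⊆ C → B ⊆ C → A ∪ B ⊆ C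
∪-⊆ {A = A} {B} A⊆C B⊆C x∈A∪B with x∈p∪q⁻ A B x∈A∪B
... | inj₁ x∈A = A⊆C x∈A
... | inj₂ x∈B = B⊆C x∈B

∪-mono : ∀ {n} {A A′ B B′ : Subset n} → A ⊆ A′ → B ⊆ B′ → A ∪ B ⊆ A′ ∪ B′
∪-mono {B′ = B′} A⊆A′ B⊆B′ = ∪-⊆ (p⊆p∪q B′ ∘ A⊆A′) (q⊆p∪q _ _ ∘ B⊆B′)

x∈⋃⁅⁆ : ∀ {n} {x : Fin n} {es : List (Fin n)} → x ∈ₗ es → x ∈ ⋃ (map ⁅_⁆ es)
x∈⋃⁅⁆ {es = e ∷ es} (here refl) = p⊆p∪q (⋃ (map ⁅_⁆ es)) (x∈⁅x⁆ e)
x∈⋃⁅⁆ {es = e ∷ es} (there x∈es) = q⊆p∪q ⁅ e ⁆ _ (x∈⋃⁅⁆ x∈es)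

⊆⇒∩∁≡⊥ : ∀ {n} {A W : Subset n} → A ⊆ W → A ∩ ∁ W ≡ ⊥
⊆⇒∩∁≡⊥ {A = A} {W} A⊆W = Empty-unique λ (x , x∈A∩∁W) →
  let x∈A , x∈∁W = x∈p∩q⁻ A (∁ W) x∈A∩∁W in x∈∁p⇒x∉p x∈∁W (A⊆W x∈A)

groundMinor-∁-⊆ : ∀ {n} {C W : Subset n} → groundMinor C (∁ W) ⊆ W
groundMinor-∁-⊆ {C = C} x∈ground = x∉∁p⇒x∈p (x∈∁p⇒x∉p x∈ground ∘ q⊆p∪q C _)

⊆-groundMinor-∁ : ∀ {n} {A C W : Subset n} → A ⊆ W → (∀ {x} → x ∈ A → x ∉ C) →
                  A ⊆ groundMinor C (∁ W)
⊆-groundMinor-∁ {C = C} {W} A⊆W A-avoids-C x∈A = x∉p⇒x∈∁p λ x∈C∪∁W →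
  [ A-avoids-C x∈A , (λ x∈∁W → x∈∁p⇒x∉p x∈∁W (A⊆W x∈A)) ]′ (x∈p∪q⁻ C (∁ W) x∈C∪∁W)

module MatroidRank {n : ℕ} (M : Matroid n) where

  open Matroid M public using () renaming (r to rk; r-card to rk-card; r-mono to rk-mono; r-submod to rk-submod)

  rk-≤-rankM : ∀ A → rk A ≤ rankM M
  rk-≤-rankM A = rk-mono ⊆⊤

  rk-submod-⊆ : ∀ {P Q A B} → P ⊆ A ∪ B → Q ⊆ A ∩ B → rk P + rk Q ≤ rk A + rk B
  rk-submod-⊆ {A = A} {B} P⊆ Q⊆ = ≤-trans (+-mono-≤ (rk-mono P⊆) (rk-mono Q⊆)) (rk-submod A B)

  rk-∪-≤ : ∀ A B → rk (A ∪ B) ≤ rk A + rk B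
  rk-∪-≤ A B = ≤-trans (m≤m+n _ _) (rk-submod A B)

  rk-∪⁅⁆-≤ : ∀ A e → rk (A ∪ ⁅ e ⁆) ≤ suc (rk A)
  rk-∪⁅⁆-≤ A e = begin
    rk (A ∪ ⁅ e ⁆)    ≤⟨ rk-∪-≤ A ⁅ e ⁆ ⟩
    rk A + rk ⁅ e ⁆   ≤⟨ +-monoʳ-≤ (rk A) (subst (rk ⁅ e ⁆ ≤_) (∣⁅x⁆∣≡1 e) (rk-card ⁅ e ⁆)) ⟩
    rk A + 1          ≡⟨ +-comm (rk A) 1 ⟩
    suc (rk A)        ∎
    where open ≤-Reasoning

  rk-∪-spanned : ∀ S A B → rk (S ∪ A) ≤ rk S → rk (S ∪ B) ≤ rk S → rk (S ∪ (A ∪ B)) ≤ rk S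
  rk-∪-spanned S A B SA≤S SB≤S = +-cancelʳ-≤ (rk S) _ _ (begin
    rk (S ∪ (A ∪ B)) + rk S      ≤⟨ rk-submod-⊆ (∪-⊆ (p⊆p∪q _ ∘ p⊆p∪q A) (∪-mono (q⊆p∪q S A) (q⊆p∪q S B)))
                                                 (λ x∈S → x∈p∩q⁺ (p⊆p∪q A x∈S , p⊆p∪q B x∈S)) ⟩
    rk (S ∪ A) + rk (S ∪ B)      ≤⟨ +-mono-≤ SA≤S SB≤S ⟩
    rk S + rk S                  ∎)
    where open ≤-Reasoning

  cl : Subset n → Subset n
  cl S = tabulate λ e → rk (S ∪ ⁅ e ⁆) ≤ᵇ rk S

  ∈-cl⁺ : ∀ {S e} → rk (S ∪ ⁅ e ⁆) ≤ rk S → e ∈ cl S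
  ∈-cl⁺ {S} {e} spanned =
    lookup⇒[]= e (cl S) (trans (lookup∘tabulate _ e) (Equivalence.to T-≡ (≤⇒≤ᵇ spanned)))

  ∈-cl⁻ : ∀ {S e} → e ∈ cl S → rk (S ∪ ⁅ e ⁆) ≤ rk S
  ∈-cl⁻ {S} {e} e∈cl =
    ≤ᵇ⇒≤ _ _ (Equivalence.from T-≡ (trans (sym (lookup∘tabulate _ e)) ([]=⇒lookup e∈cl)))

  ∉-cl⁻ : ∀ {S e} → e ∉ cl S → rk S < rk (S ∪ ⁅ e ⁆)
  ∉-cl⁻ e∉cl = ≰⇒> (e∉cl ∘ ∈-cl⁺)

  ∉-cl⇒∉ : ∀ {S e} → e ∉ cl S → e ∉ S
  ∉-cl⇒∉ {S} {e} e∉cl e∈S =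
    e∉cl (∈-cl⁺ (rk-mono (∪-⊆ (λ x∈S → x∈S) (λ x∈e → subst (_∈ S) (sym (x∈⁅y⁆⇒x≡y e x∈e)) e∈S))))

  rk-∪-⋃⁅⁆-≤ : ∀ S (es : List (Fin n)) → All (_∈ cl S) es → rk (S ∪ ⋃ (map ⁅_⁆ es)) ≤ rk S
  rk-∪-⋃⁅⁆-≤ S [] [] = ≤-reflexive (cong rk (∪-identityʳ S))
  rk-∪-⋃⁅⁆-≤ S (e ∷ es) (e∈cl ∷ es⊆cl) =
    rk-∪-spanned S ⁅ e ⁆ (⋃ (map ⁅_⁆ es)) (∈-cl⁻ e∈cl) (rk-∪-⋃⁅⁆-≤ S es es⊆cl)

  rk-cl-≤ : ∀ S → rk (cl S) ≤ rk S
  rk-cl-≤ S = ≤-trans (rk-mono cl⊆) (rk-∪-⋃⁅⁆-≤ S elements (all-filter (_∈? cl S) (allFin n)))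
    where
    elements : List (Fin n)
    elements = filter (_∈? cl S) (allFin n)
    cl⊆ : cl S ⊆ S ∪ ⋃ (map ⁅_⁆ elements)
    cl⊆ {e} e∈cl = q⊆p∪q S _ (x∈⋃⁅⁆ (∈-filter⁺ (_∈? cl S) (∈-allFin e) e∈cl))

  weaklyRound⇒∉cl×∉cl : WeaklyRound M → ∀ A B → rk A + 2 ≤ rankM M → rk B + 1 ≤ rankM M →
                        ∃ λ e → e ∉ cl A × e ∉ cl B
  weaklyRound⇒∉cl×∉cl wr A B A-small B-small
    with any? (λ e → ¬? (e ∈? cl A) ×-dec ¬? (e ∈? cl B))
  ... | yes outside-both = outside-both
  ... | no none = contradiction (cl A , cl B , covers , A-small′ , B-small′) wr
    where
    covered : ∀ e → e ∈ cl A ∪ cl B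
    covered e with e ∈? cl A | e ∈? cl B
    ... | yes e∈clA | _         = x∈p∪q⁺ (inj₁ e∈clA)
    ... | no _      | yes e∈clB = x∈p∪q⁺ (inj₂ e∈clB)
    ... | no e∉clA  | no e∉clB  = contradiction (e , e∉clA , e∉clB) none
    covers : cl A ∪ cl B ≡ ⊤
    covers = ⊆-antisym ⊆⊤ (λ {e} _ → covered e)
    A-small′ : rk (cl A) + 2 ≤ rankM M
    A-small′ = ≤-trans (+-monoˡ-≤ 2 (rk-cl-≤ A)) A-small
    B-small′ : rk (cl B) + 1 ≤ rankM M
    B-small′ = ≤-trans (+-monoˡ-≤ 1 (rk-cl-≤ B)) B-small

  Skew : Subset n → Subset n → Set
  Skew W C = rk W + rk C ≤ rk (W ∪ C)

  skew-⊥ : ∀ W → Skew W ⊥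
  skew-⊥ W = begin
    rk W + rk ⊥    ≡⟨ cong (rk W +_) rk-⊥≡0 ⟩
    rk W + 0       ≡⟨ +-identityʳ (rk W) ⟩
    rk W           ≡⟨ cong rk (sym (∪-identityʳ W)) ⟩
    rk (W ∪ ⊥)     ∎
    where
    open ≤-Reasoning
    rk-⊥≡0 : rk ⊥ ≡ 0
    rk-⊥≡0 = n≤0⇒n≡0 (subst (rk ⊥ ≤_) (∣⊥∣≡0 n) (rk-card ⊥))

  skew-⊆ : ∀ {W C Z} → Skew W C → Z ⊆ W → rk (Z ∪ C) ≡ rk Z + rk C
  skew-⊆ {W} {C} {Z} W-skew-C Z⊆W = ≤-antisym (rk-∪-≤ Z C) (+-cancelˡ-≤ (rk W) _ _ (begin
    rk W + (rk Z + rk C)   ≡⟨ cong (rk W +_) (+-comm (rk Z) (rk C)) ⟩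
    rk W + (rk C + rk Z)   ≡⟨ sym (+-assoc (rk W) (rk C) (rk Z)) ⟩
    rk W + rk C + rk Z     ≤⟨ +-monoˡ-≤ (rk Z) W-skew-C ⟩
    rk (W ∪ C) + rk Z      ≤⟨ rk-submod-⊆ (∪-⊆ (q⊆p∪q (Z ∪ C) W) (p⊆p∪q W ∘ q⊆p∪q Z C)) Z⊆Z∪C∩W ⟩
    rk (Z ∪ C) + rk W      ≡⟨ +-comm (rk (Z ∪ C)) (rk W) ⟩
    rk W + rk (Z ∪ C)      ∎))
    where
    open ≤-Reasoning
    Z⊆Z∪C∩W : Z ⊆ (Z ∪ C) ∩ W
    Z⊆Z∪C∩W x∈Z = x∈p∩q⁺ (p⊆p∪q C x∈Z , Z⊆W x∈Z)

  skew-∪⁅⁆ : ∀ {W C e} → Skew W C → e ∉ cl (W ∪ C) → Skew W (C ∪ ⁅ e ⁆)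
  skew-∪⁅⁆ {W} {C} {e} W-skew-C e∉cl = begin
    rk W + rk (C ∪ ⁅ e ⁆)   ≤⟨ +-monoʳ-≤ (rk W) (rk-∪⁅⁆-≤ C e) ⟩
    rk W + suc (rk C)       ≡⟨ +-suc (rk W) (rk C) ⟩
    suc (rk W + rk C)       ≤⟨ s≤s W-skew-C ⟩
    suc (rk (W ∪ C))        ≤⟨ ∉-cl⁻ e∉cl ⟩
    rk ((W ∪ C) ∪ ⁅ e ⁆)    ≡⟨ cong rk (∪-assoc W C ⁅ e ⁆) ⟩
    rk (W ∪ (C ∪ ⁅ e ⁆))    ∎
    where open ≤-Reasoning

  rankMinor-skew : ∀ {W C Z} → Skew W C → Z ⊆ W → rankMinor M C Z ≡ rk Z
  rankMinor-skew {C = C} {Z} W-skew-C Z⊆W = begin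
    rk (Z ∪ C) ∸ rk C    ≡⟨ cong (_∸ rk C) (skew-⊆ W-skew-C Z⊆W) ⟩
    rk Z + rk C ∸ rk C   ≡⟨ m+n∸n≡m (rk Z) (rk C) ⟩
    rk Z                 ∎
    where open ≡-Reasoning

module Contraction {n : ℕ} (M : Matroid n) (X Y : Subset n) where

  open MatroidRank M

  record Admissible (C : Subset n) : Set where
    field
      X-avoids-C : ∀ {x} → x ∈ X → x ∉ C
      Y-avoids-C : ∀ {y} → y ∈ Y → y ∉ C
      X-skew-C   : Skew X C
      Y-skew-C   : Skew Y C

  open Admissible

  admissible-⊥ : Admissible ⊥
  admissible-⊥ = record
    { X-avoids-C = λ _ → ∉⊥
    ; Y-avoids-C = λ _ → ∉⊥
    ; X-skew-C   = skew-⊥ X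
    ; Y-skew-C   = skew-⊥ Y
    }

  avoids-∪⁅⁆ : ∀ {W C e} → (∀ {x} → x ∈ W → x ∉ C) → e ∉ cl (W ∪ C) →
               ∀ {x} → x ∈ W → x ∉ C ∪ ⁅ e ⁆
  avoids-∪⁅⁆ {W} {C} {e} W-avoids-C e∉cl {x} x∈W x∈C∪e =
    [ W-avoids-C x∈W , (λ x∈e → ∉-cl⇒∉ e∉cl (p⊆p∪q C (subst (_∈ W) (x∈⁅y⁆⇒x≡y e x∈e) x∈W))) ]′
      (x∈p∪q⁻ C ⁅ e ⁆ x∈C∪e)

  admissible-∪⁅⁆ : ∀ {C e} → Admissible C → e ∉ cl (X ∪ C) → e ∉ cl (Y ∪ C) →
                   Admissible (C ∪ ⁅ e ⁆)
  admissible-∪⁅⁆ adm e∉clX e∉clY = record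
    { X-avoids-C = avoids-∪⁅⁆ (X-avoids-C adm) e∉clX
    ; Y-avoids-C = avoids-∪⁅⁆ (Y-avoids-C adm) e∉clY
    ; X-skew-C   = skew-∪⁅⁆ (X-skew-C adm) e∉clX
    ; Y-skew-C   = skew-∪⁅⁆ (Y-skew-C adm) e∉clY
    }

  admissible⇒goodMinor : ∀ {C} → Admissible C → rk ((X ∪ Y) ∪ C) ≤ rk (Y ∪ C) →
                         GoodMinor M X Y C (∁ ((X ∪ Y) ∪ C))
  admissible⇒goodMinor {C} adm Y∪C-spans =
    ⊆⇒∩∁≡⊥ C⊆W ,
    X⊆ground , (λ Z Z⊆X → rankMinor-skew (X-skew-C adm) Z⊆X) ,
    Y⊆ground , (λ Z Z⊆Y → rankMinor-skew (Y-skew-C adm) Z⊆Y) ,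
    cong (_∸ rk C) (≤-antisym (rk-mono (∪-mono Y⊆ground (λ x∈C → x∈C)))
                              (≤-trans (rk-mono (∪-⊆ groundMinor-∁-⊆ C⊆W)) Y∪C-spans))
    where
    W = (X ∪ Y) ∪ C
    C⊆W : C ⊆ W
    C⊆W = q⊆p∪q (X ∪ Y) C
    X⊆ground : X ⊆ groundMinor C (∁ W)
    X⊆ground = ⊆-groundMinor-∁ (p⊆p∪q C ∘ p⊆p∪q Y) (X-avoids-C adm)
    Y⊆ground : Y ⊆ groundMinor C (∁ W)
    Y⊆ground = ⊆-groundMinor-∁ (p⊆p∪q C ∘ q⊆p∪q X Y) (Y-avoids-C adm)

  -- k bounds the remaining contractions: each one raises rk (Y ∪ C).
  contract : WeaklyRound M → rk X < rk Y → ∀ k C → Admissible C → rankM M ≤ rk (Y ∪ C) + k →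
             Σ (Subset n) λ C′ → Σ (Subset n) λ D → GoodMinor M X Y C′ D
  contract _ _ zero C adm Y∪C-spans-M = C , _ , admissible⇒goodMinor adm
    (≤-trans (rk-≤-rankM _) (≤-trans Y∪C-spans-M (≤-reflexive (+-identityʳ _))))
  contract wr rX<rY (suc k) C adm bound with rk ((X ∪ Y) ∪ C) ≤? rk (Y ∪ C)
  ... | yes Y∪C-spans = C , _ , admissible⇒goodMinor adm Y∪C-spans
  ... | no Y∪C-does-not-span
    with weaklyRound⇒∉cl×∉cl wr (X ∪ C) (Y ∪ C) X∪C-small (subst (_≤ rankM M) (+-comm 1 _) Y∪C<rankM)
    where
    open ≤-Reasoning
    Y∪C<rankM : rk (Y ∪ C) < rankM M
    Y∪C<rankM = ≤-trans (≰⇒> Y∪C-does-not-span) (rk-≤-rankM _)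
    X∪C-small : rk (X ∪ C) + 2 ≤ rankM M
    X∪C-small = begin
      rk (X ∪ C) + 2         ≤⟨ +-monoˡ-≤ 2 (rk-∪-≤ X C) ⟩
      rk X + rk C + 2        ≡⟨ +-comm (rk X + rk C) 2 ⟩
      2 + (rk X + rk C)      ≤⟨ s≤s (+-monoˡ-≤ (rk C) rX<rY) ⟩
      suc (rk Y + rk C)      ≤⟨ s≤s (Y-skew-C adm) ⟩
      suc (rk (Y ∪ C))       ≤⟨ Y∪C<rankM ⟩
      rankM M                ∎
  ... | e , e∉clX , e∉clY =
    contract wr rX<rY k (C ∪ ⁅ e ⁆) (admissible-∪⁅⁆ adm e∉clX e∉clY) (begin
      rankM M                     ≤⟨ bound ⟩
      rk (Y ∪ C) + suc k          ≡⟨ +-suc (rk (Y ∪ C)) k ⟩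
      suc (rk (Y ∪ C)) + k        ≤⟨ +-monoˡ-≤ k (∉-cl⁻ e∉clY) ⟩
      rk ((Y ∪ C) ∪ ⁅ e ⁆) + k    ≡⟨ cong (λ S → rk S + k) (∪-assoc Y C ⁅ e ⁆) ⟩
      rk (Y ∪ (C ∪ ⁅ e ⁆)) + k    ∎)
    where open ≤-Reasoning

lemma7p2 : ∀ {n} (M : Matroid n) → WeaklyRound M → (X Y : Subset n) →
    r M X < r M Y →
    Σ (Subset n) λ C → Σ (Subset n) λ D → GoodMinor M X Y C D
lemma7p2 M wr X Y rX<rY =
  contract wr rX<rY (rankM M) ⊥ admissible-⊥ (m≤n+m (rankM M) (r M (Y ∪ ⊥)))
  where open Contraction M X Y
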